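{- Let $\ell$ be a positive integer. Take the vertex set of the complete graph $K_{4\ell+2}$ to be $\{x_i : i\in\mathbb{Z}_{2\ell+1}\}\cup\{y_i : i\in\mathbb{Z}_{2\ell+1}\}$, and let $L=\{1,2,\ldots,\ell\}$. Suppose $K_{4\ell+2}$ has 1-factors $F_1$ and $F_2$ such that (i) for each $d\in L$, $E(F_1)\cup E(F_2)$ contains exactly one edge of left pure length $d$ and exactly one edge of right pure length $d$, and for each $d\in\mathbb{Z}_{2\ell+1}\setminus\{0\}$, $E(F_1)\cup E(F_2)$ contains exactly one edge of mixed difference $d$; and (ii) each of $F_1$ and $F_2$ contains exactly one edge of mixed difference $0$. Then $K_{4\ell+3}^*$ admits a $(\vec{C}_2,\ldots,\vec{C}_2,\vec{C}_3)$-factorization.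
   Context: For $i\in\mathbb{Z}_{k}$ and $d\in\{1,\ldots,\lfloor k/2\rfloor\}$, an edge $x_ix_{i+d}$ (resp. $y_iy_{i+d}$) of $K_{2k}$ on vertex set $\{x_i\}_{i\in\mathbb{Z}_k}\cup\{y_i\}_{i\in\mathbb{Z}_k}$ is called an edge of left (resp. right) pure length $d$; an edge $x_iy_{i+d}$ with $i,d\in\mathbb{Z}_k$ is called an edge of mixed difference $d$. Here $k=2\ell+1$. $K_n^*$ denotes the complete symmetric digraph on $n$ vertices. $\vec{C}_m$ denotes a directed cycle of length $m$ ($\vec{C}_2$ on $u,v$ is the pair of arcs $(u,v),(v,u)$). A $(\vec{C}_2,\ldots,\vec{C}_2,\vec{C}_3)$-factor of a digraph on $n$ vertices ($n$ odd) is a spanning subdigraph consisting of $(n-3)/2$ directed 2-cycles and one directed 3-cycle, all pairwise vertex-disjoint; a $(\vec{C}_2,\ldots,\vec{C}_2,\vec{C}_3)$-factorization is a partition of the arc set into such factors. -}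

module Defs where

open import Data.Nat using (ℕ; zero; suc; _+_; _*_; _∸_; _≤_; _<_; NonZero)
open import Data.Nat.DivMod using (_%_)
open import Data.Fin using (Fin; toℕ)
open import Data.Product using (Σ; _×_; _,_)
open import Data.Sum using (_⊎_)
open import Data.Empty using (⊥)
open import Relation.Binary.PropositionalEquality using (_≡_; _≢_)

data Vtx (k : ℕ) : Set where
  x : Fin k → Vtx k
  y : Fin k → Vtx k

diff : (k : ℕ) → .{{_ : NonZero k}} → Fin k → Fin k → ℕ
diff k a b = (k + toℕ b ∸ toℕ a) % k

LeftPure : (k : ℕ) → .{{_ : NonZero k}} → ℕ → Vtx k → Vtx k → Set
LeftPure k d (x a) (x b) = (diff k a b ≡ d) ⊎ (diff k b a ≡ d)
LeftPure k d _ _ = ⊥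

RightPure : (k : ℕ) → .{{_ : NonZero k}} → ℕ → Vtx k → Vtx k → Set
RightPure k d (y a) (y b) = (diff k a b ≡ d) ⊎ (diff k b a ≡ d)
RightPure k d _ _ = ⊥

Mixed : (k : ℕ) → .{{_ : NonZero k}} → ℕ → Vtx k → Vtx k → Set
Mixed k d (x a) (y b) = diff k a b ≡ d
Mixed k d (y b) (x a) = diff k a b ≡ d
Mixed k d _ _ = ⊥

-- A 1-factor (perfect matching) of the complete graph on V, represented by
-- its partner map: v is matched with f v.  Edges of the factor: {v, f v}.
IsOneFactor : {V : Set} → (V → V) → Set
IsOneFactor {V} f = (∀ v → f v ≢ v) × (∀ v → f (f v) ≡ v)

InUnion : {V : Set} → (V → V) → (V → V) → V → V → Set
InUnion f₁ f₂ u w = (f₁ u ≡ w) ⊎ (f₂ u ≡ w)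

-- there is exactly one unordered pair {u,w} satisfying P
-- (P is meant to be symmetric; pairs are identified up to swapping)
ExactlyOneEdge : {V : Set} → (V → V → Set) → Set
ExactlyOneEdge {V} P =
  Σ V λ u → Σ V λ w → P u w ×
    (∀ u' w' → P u' w' → ((u' ≡ u) × (w' ≡ w)) ⊎ ((u' ≡ w) × (w' ≡ u)))

-- A spanning subdigraph in which every vertex
-- lies on exactly one (directed) cycle has out-degree one everywhere, so it
-- is given by its successor map σ : its arcs are (v , σ v).
-- (C₂,…,C₂,C₃)-factor: one directed 3-cycle c → σ c → σ(σ c) → c, and every
-- other vertex lies on a directed 2-cycle v → σ v → v.

IsC23Factor : (n : ℕ) → (Fin n → Fin n) → Set
IsC23Factor n σ =
  Σ (Fin n) λ c →
    (σ c ≢ c) × (σ (σ c) ≢ c) × (σ (σ (σ c)) ≡ c) ×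
    (∀ v → ((v ≡ c) ⊎ (v ≡ σ c) ⊎ (v ≡ σ (σ c)))
         ⊎ ((σ v ≢ v) × (σ (σ v) ≡ v)))

HasC23Factorization : ℕ → Set
HasC23Factorization n =
  Σ ℕ λ m → Σ (Fin m → Fin n → Fin n) λ F →
    (∀ j → IsC23Factor n (F j)) ×
    (∀ u v → u ≢ v →
      Σ (Fin m) λ j → (F j u ≡ v) × (∀ j' → F j' u ≡ v → j' ≡ j))

-- Adjoin a vertex ∞ to the x's and y's. The zero-difference edge {x_a, y_a} of F₁ becomes the
-- 3-cycle ∞ → x_a → y_a → ∞ and every other edge of F₁ a 2-cycle; F₂ gives a second such factor
-- whose 3-cycle ∞ → y_b → x_b → ∞ runs the other way. The 2(2ℓ+1) rotations i ↦ i + t of these two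
-- factors form the factorization: by (i), every arc between distinct finite vertices that is not
-- of the form x_i ↔ y_i lies, up to rotation, on a 2-cycle of a base factor (an edge of pure length
-- d serves the differences ±d), and all remaining arcs lie on rotated 3-cycles. Since there are
-- 4ℓ+2 factors on 4ℓ+3 vertices and none fixes a vertex, every arc is then covered exactly once.

module Submission where

open import Defs
open import Data.Nat using (ℕ; suc; _+_; _*_; _≤_; _<_)
open import Data.Product using (_×_)
open import Relation.Binary.PropositionalEquality using (_≡_)

open import Data.Nat using (zero; _∸_; NonZero)
open import Data.Nat.Properties as ℕ using ()
open import Data.Nat.DivMod using (_%_; m%n<n; m<n⇒m%n≡m; m%n%n≡m%n; %-distribˡ-+; [m+n]%n≡m%n; n%n≡0)
open import Data.Nat.Tactic.RingSolver using (solve-∀)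
open import Data.Bool as Bool using (Bool; true; false)
open import Data.Fin as Fin using (Fin; toℕ; fromℕ<; punchOut; punchIn)
open import Data.Fin.Properties using (toℕ-fromℕ<; toℕ-injective; toℕ<n; any?; punchOut-injective;
  punchOut-cong; punchOut-punchIn; punchInᵢ≢i; injective⇒≤; +↔⊎; *↔×; 1↔⊤; 2↔Bool)
open import Data.Product using (Σ; ∃; _,_; proj₁; proj₂)
open import Data.Product.Properties using (≡-dec)
open import Data.Product.Function.NonDependent.Propositional using (_×-↔_)
open import Data.Sum using (_⊎_; inj₁; inj₂)
open import Data.Sum.Function.Propositional using (_⊎-↔_)
open import Data.Sum.Properties using (inj₂-injective)
open import Data.Unit using (⊤; tt)
open import Function using (_∘_)
open import Function.Bundles using (_↔_; Inverse; Injection; mk↔ₛ′)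
open import Function.Definitions using (Injective)
open import Function.Properties.Inverse using (↔-refl; ↔-sym; ↔-trans; ↔⇒↣)
open import Relation.Binary.Definitions using (DecidableEquality)
open import Relation.Binary.PropositionalEquality
  using (_≢_; refl; sym; trans; cong; subst; module ≡-Reasoning)
open import Relation.Nullary using (¬_; Dec; yes; no; contradiction)
open import Relation.Nullary.Decidable using (via-injection)

injective⇒surjective : ∀ {n} {f : Fin n → Fin n} → Injective _≡_ _≡_ f → ∀ j → ∃ λ i → f i ≡ j
injective⇒surjective {zero} _ ()
injective⇒surjective {suc m} {f} f-injective j with any? (λ i → f i Fin.≟ j)
... | yes hit = hit
... | no missed = contradiction (injective⇒≤ f′-injective) (ℕ.n≮n m)
  where
  f′ : Fin (suc m) → Fin m
  f′ i = punchOut {i = j} (λ j≡fi → missed (i , sym j≡fi))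

  f′-injective : Injective _≡_ _≡_ f′
  f′-injective = f-injective ∘ punchOut-injective {i = j} _ _

rightInverse⇒injective : ∀ {n} (f g : Fin n → Fin n) → (∀ w → f (g w) ≡ w) →
  Injective _≡_ _≡_ f
rightInverse⇒injective f g f∘g≡id {i} {j} fi≡fj = begin
  i         ≡⟨ g∘f≡id i ⟨
  g (f i)   ≡⟨ cong g fi≡fj ⟩
  g (f j)   ≡⟨ g∘f≡id j ⟩
  j         ∎
  where
  open ≡-Reasoning

  g-injective : Injective _≡_ _≡_ g
  g-injective {a} {b} ga≡gb = trans (sym (f∘g≡id a)) (trans (cong f ga≡gb) (f∘g≡id b))

  g∘f≡id : ∀ i → g (f i) ≡ i
  g∘f≡id i with w , gw≡i ← injective⇒surjective g-injective i =
    trans (cong (g ∘ f) (sym gw≡i)) (trans (cong g (f∘g≡id w)) gw≡i)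

punctured-surjection⇒injective : ∀ {m} (h : Fin m → Fin (suc m)) (u : Fin (suc m)) →
  (∀ j → h j ≢ u) → (∀ v → u ≢ v → ∃ λ j → h j ≡ v) → Injective _≡_ _≡_ h
punctured-surjection⇒injective {m} h u h≢u h-onto =
  rightInverse⇒injective h′ section h′∘section≡id ∘ punchOut-cong u
  where
  h′ : Fin m → Fin m
  h′ j = punchOut (h≢u j ∘ sym)

  section : Fin m → Fin m
  section w = proj₁ (h-onto (punchIn u w) (punchInᵢ≢i u w ∘ sym))

  h′∘section≡id : ∀ w → h′ (section w) ≡ w
  h′∘section≡id w =
    trans (punchOut-cong u (proj₂ (h-onto (punchIn u w) (punchInᵢ≢i u w ∘ sym)))) (punchOut-punchIn u)

IsC23Map : {V : Set} → (V → V) → Set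
IsC23Map {V} σ =
  Σ V λ c →
    (σ c ≢ c) × (σ (σ c) ≢ c) × (σ (σ (σ c)) ≡ c) ×
    (∀ v → ((v ≡ c) ⊎ (v ≡ σ c) ⊎ (v ≡ σ (σ c)))
         ⊎ ((σ v ≢ v) × (σ (σ v) ≡ v)))

IsC23Map⇒fixedPointFree : ∀ {V} {σ : V → V} → IsC23Map σ → ∀ v → σ v ≢ v
IsC23Map⇒fixedPointFree {σ = σ} (c , σc≢c , σ²c≢c , σ³c≡c , classify) v with classify v
... | inj₂ (σv≢v , _)          = σv≢v
... | inj₁ (inj₁ refl)          = σc≢c
... | inj₁ (inj₂ (inj₁ refl))   = λ σ²c≡σc → σc≢c (trans (sym σ²c≡σc) (trans (cong σ (sym σ²c≡σc)) σ³c≡c))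
... | inj₁ (inj₂ (inj₂ refl))   = λ σ³c≡σ²c → σ²c≢c (trans (sym σ³c≡σ²c) σ³c≡c)

module _ {A B : Set} (e : A ↔ B) where
  open Inverse e

  conjugate : (A → A) → B → B
  conjugate σ = to ∘ σ ∘ from

  conjugate-to : ∀ σ a → conjugate σ (to a) ≡ to (σ a)
  conjugate-to σ a = cong (to ∘ σ) (strictlyInverseʳ a)

  IsC23Map-conjugate : ∀ {σ} → IsC23Map σ → IsC23Map (conjugate σ)
  IsC23Map-conjugate {σ} (c , σc≢c , σ²c≢c , σ³c≡c , classify) =
    to c , (σc≢c ∘ to-injective ∘ trans (sym τ¹)) , (σ²c≢c ∘ to-injective ∘ trans (sym τ²)) ,
    trans τ³ (cong to σ³c≡c) , classify′
    where
    τ : B → B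
    τ = conjugate σ

    to-injective : Injective _≡_ _≡_ to
    to-injective = Injection.injective (↔⇒↣ e)

    τ¹ : τ (to c) ≡ to (σ c)
    τ¹ = conjugate-to σ c
    τ² : τ (τ (to c)) ≡ to (σ (σ c))
    τ² = trans (cong τ τ¹) (conjugate-to σ (σ c))
    τ³ : τ (τ (τ (to c))) ≡ to (σ (σ (σ c)))
    τ³ = trans (cong τ τ²) (conjugate-to σ (σ (σ c)))

    classify′ : ∀ b → ((b ≡ to c) ⊎ (b ≡ τ (to c)) ⊎ (b ≡ τ (τ (to c)))) ⊎ ((τ b ≢ b) × (τ (τ b) ≡ b))
    classify′ b with classify (from b)
    ... | inj₁ (inj₁ eq)          = inj₁ (inj₁ (trans (sym (strictlyInverseˡ b)) (cong to eq)))
    ... | inj₁ (inj₂ (inj₁ eq))   = inj₁ (inj₂ (inj₁ (trans (sym (strictlyInverseˡ b)) (trans (cong to eq) (sym τ¹)))))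
    ... | inj₁ (inj₂ (inj₂ eq))   = inj₁ (inj₂ (inj₂ (trans (sym (strictlyInverseˡ b)) (trans (cong to eq) (sym τ²)))))
    ... | inj₂ (σv≢v , σ²v≡v)     =
      inj₂ ((λ τb≡b → σv≢v (trans (sym (strictlyInverseʳ _)) (cong from τb≡b))) ,
            trans (conjugate-to σ (σ (from b))) (trans (cong to σ²v≡v) (strictlyInverseˡ b)))

c23Factorization : ∀ {m} (F : Fin m → Fin (suc m) → Fin (suc m)) → (∀ j → IsC23Map (F j)) →
  (∀ u v → u ≢ v → ∃ λ j → F j u ≡ v) → HasC23Factorization (suc m)
c23Factorization {m} F F-c23 F-covers = m , F , F-c23 , unique-cover
  where
  unique-cover : ∀ u v → u ≢ v → Σ (Fin m) λ j → (F j u ≡ v) × (∀ j′ → F j′ u ≡ v → j′ ≡ j)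
  unique-cover u v u≢v with j , Fju≡v ← F-covers u v u≢v =
    j , Fju≡v , λ j′ Fj′u≡v →
      punctured-surjection⇒injective (λ j → F j u) u (λ j → IsC23Map⇒fixedPointFree (F-c23 j) u)
        (F-covers u) (trans Fj′u≡v (sym Fju≡v))

c23Factorization-via : ∀ {m} {W I : Set} → W ↔ Fin (suc m) → I ↔ Fin m →
  (σ : I → W → W) → (∀ i → IsC23Map (σ i)) → (∀ u v → u ≢ v → ∃ λ i → σ i u ≡ v) →
  HasC23Factorization (suc m)
c23Factorization-via {m} W↔ I↔ σ σ-c23 σ-covers =
  c23Factorization F (λ j → IsC23Map-conjugate W↔ (σ-c23 (from I↔ j))) F-covers
  where
  open Inverse using (to; from; strictlyInverseˡ; strictlyInverseʳ)

  F : Fin m → Fin (suc m) → Fin (suc m)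
  F j = conjugate W↔ (σ (from I↔ j))

  from-injective : Injective _≡_ _≡_ (from W↔)
  from-injective = Injection.injective (↔⇒↣ (↔-sym W↔))

  F-covers : ∀ u v → u ≢ v → ∃ λ j → F j u ≡ v
  F-covers u v u≢v with i , σiu≡v ← σ-covers (from W↔ u) (from W↔ v) (u≢v ∘ from-injective) =
    to I↔ i , (begin
      to W↔ (σ (from I↔ (to I↔ i)) (from W↔ u)) ≡⟨ cong (λ i′ → to W↔ (σ i′ (from W↔ u))) (strictlyInverseʳ I↔ i) ⟩
      to W↔ (σ i (from W↔ u))                   ≡⟨ cong (to W↔) σiu≡v ⟩
      to W↔ (from W↔ v)                         ≡⟨ strictlyInverseˡ W↔ v ⟩
      v                                         ∎)
    where open ≡-Reasoning

module Cyclic (k : ℕ) .{{_ : NonZero k}} where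

  infixl 6 _⊕_
  _⊕_ : Fin k → ℕ → Fin k
  i ⊕ n = fromℕ< (m%n<n (toℕ i + n) k)

  private
    toℕ-⊕ : ∀ i n → toℕ (i ⊕ n) ≡ (toℕ i + n) % k
    toℕ-⊕ i n = toℕ-fromℕ< (m%n<n (toℕ i + n) k)

    toℕ%k : ∀ (i : Fin k) → toℕ i % k ≡ toℕ i
    toℕ%k i = m<n⇒m%n≡m (toℕ<n i)

    [m+n%k]%k : ∀ m n → (m + n % k) % k ≡ (m + n) % k
    [m+n%k]%k m n = begin
      (m + n % k) % k           ≡⟨ %-distribˡ-+ m (n % k) k ⟩
      (m % k + n % k % k) % k   ≡⟨ cong (λ r → (m % k + r) % k) (m%n%n≡m%n n k) ⟩
      (m % k + n % k) % k       ≡⟨ %-distribˡ-+ m n k ⟨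
      (m + n) % k               ∎
      where open ≡-Reasoning

  ⊕-assoc : ∀ i m n → i ⊕ m ⊕ n ≡ i ⊕ (m + n)
  ⊕-assoc i m n = toℕ-injective (begin
    toℕ (i ⊕ m ⊕ n)              ≡⟨ toℕ-⊕ (i ⊕ m) n ⟩
    (toℕ (i ⊕ m) + n) % k        ≡⟨ cong (λ r → (r + n) % k) (toℕ-⊕ i m) ⟩
    ((toℕ i + m) % k + n) % k    ≡⟨ cong (_% k) (ℕ.+-comm _ n) ⟩
    (n + (toℕ i + m) % k) % k    ≡⟨ [m+n%k]%k n (toℕ i + m) ⟩
    (n + (toℕ i + m)) % k        ≡⟨ cong (_% k) (ℕ.+-comm n _) ⟩
    (toℕ i + m + n) % k          ≡⟨ cong (_% k) (ℕ.+-assoc (toℕ i) m n) ⟩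
    (toℕ i + (m + n)) % k        ≡⟨ toℕ-⊕ i (m + n) ⟨
    toℕ (i ⊕ (m + n))            ∎)
    where open ≡-Reasoning

  ⊕-right-comm : ∀ i m n → i ⊕ m ⊕ n ≡ i ⊕ n ⊕ m
  ⊕-right-comm i m n = trans (⊕-assoc i m n) (trans (cong (i ⊕_) (ℕ.+-comm m n)) (sym (⊕-assoc i n m)))

  ⊕-identityʳ : ∀ i → i ⊕ 0 ≡ i
  ⊕-identityʳ i = toℕ-injective (trans (toℕ-⊕ i 0) (trans (cong (_% k) (ℕ.+-identityʳ (toℕ i))) (toℕ%k i)))

  ⊕-period : ∀ i → i ⊕ k ≡ i
  ⊕-period i = toℕ-injective (trans (toℕ-⊕ i k) (trans ([m+n]%n≡m%n (toℕ i) k) (toℕ%k i)))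

  ⊕-cancelʳ : ∀ {n} i → n ≤ k → i ⊕ n ⊕ (k ∸ n) ≡ i
  ⊕-cancelʳ i n≤k = trans (⊕-assoc i _ _) (trans (cong (i ⊕_) (ℕ.m+[n∸m]≡n n≤k)) (⊕-period i))

  ⊕-cancelˡ : ∀ {n} i → n ≤ k → i ⊕ (k ∸ n) ⊕ n ≡ i
  ⊕-cancelˡ i n≤k = trans (⊕-assoc i _ _) (trans (cong (i ⊕_) (ℕ.m∸n+n≡m n≤k)) (⊕-period i))

  ⊕-diff : ∀ i j → i ⊕ diff k i j ≡ j
  ⊕-diff i j = toℕ-injective (begin
    toℕ (i ⊕ diff k i j)                   ≡⟨ toℕ-⊕ i (diff k i j) ⟩
    (toℕ i + (k + toℕ j ∸ toℕ i) % k) % k  ≡⟨ [m+n%k]%k (toℕ i) (k + toℕ j ∸ toℕ i) ⟩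
    (toℕ i + (k + toℕ j ∸ toℕ i)) % k      ≡⟨ cong (_% k) (ℕ.m+[n∸m]≡n i≤k+j) ⟩
    (k + toℕ j) % k                        ≡⟨ cong (_% k) (ℕ.+-comm k (toℕ j)) ⟩
    (toℕ j + k) % k                        ≡⟨ [m+n]%n≡m%n (toℕ j) k ⟩
    toℕ j % k                              ≡⟨ toℕ%k j ⟩
    toℕ j                                  ∎)
    where
    open ≡-Reasoning
    i≤k+j : toℕ i ≤ k + toℕ j
    i≤k+j = ℕ.≤-trans (ℕ.<⇒≤ (toℕ<n i)) (ℕ.m≤m+n k (toℕ j))

  diff⇒⊕ : ∀ i j {d} → diff k i j ≡ d → j ≡ i ⊕ d
  diff⇒⊕ i j refl = sym (⊕-diff i j)

  diff<k : ∀ i j → diff k i j < k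
  diff<k i j = m%n<n (k + toℕ j ∸ toℕ i) k

  diff-self : ∀ i → diff k i i ≡ 0
  diff-self i = trans (cong (_% k) (ℕ.m+n∸n≡m k (toℕ i))) (n%n≡0 k)

  diff≡0⇒≡ : ∀ {i j} → diff k i j ≡ 0 → i ≡ j
  diff≡0⇒≡ {i} {j} d≡0 = trans (sym (⊕-identityʳ i)) (trans (cong (i ⊕_) (sym d≡0)) (⊕-diff i j))

  ≢⇒diff>0 : ∀ {i j} → i ≢ j → 1 ≤ diff k i j
  ≢⇒diff>0 i≢j = ℕ.n≢0⇒n>0 (i≢j ∘ diff≡0⇒≡)

  ⊕-transitive : ∀ a i → Σ (Fin k) λ t → a ⊕ toℕ t ≡ i
  ⊕-transitive a i = fromℕ< (diff<k a i) , trans (cong (a ⊕_) (toℕ-fromℕ< (diff<k a i))) (⊕-diff a i)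

  ⊕-transitive-pairs : ∀ a i {b j d} → b ≡ a ⊕ d → j ≡ i ⊕ d →
    Σ (Fin k) λ t → (a ⊕ toℕ t ≡ i) × (b ⊕ toℕ t ≡ j)
  ⊕-transitive-pairs a i {b} {j} {d} b≡a⊕d j≡i⊕d with t , a⊕t≡i ← ⊕-transitive a i =
    t , a⊕t≡i , (begin
      b ⊕ toℕ t      ≡⟨ cong (_⊕ toℕ t) b≡a⊕d ⟩
      a ⊕ d ⊕ toℕ t  ≡⟨ ⊕-right-comm a d (toℕ t) ⟩
      a ⊕ toℕ t ⊕ d  ≡⟨ cong (_⊕ d) a⊕t≡i ⟩
      i ⊕ d          ≡⟨ j≡i⊕d ⟨
      j              ∎)
    where open ≡-Reasoning

module Vertices (k : ℕ) .{{_ : NonZero k}} where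
  open Cyclic k

  vtx : Bool → Fin k → Vtx k
  vtx true  = x
  vtx false = y

  Vtx↔Bool×Fin : Vtx k ↔ (Bool × Fin k)
  Vtx↔Bool×Fin = mk↔ₛ′ to from to∘from from∘to
    where
    to : Vtx k → Bool × Fin k
    to (x i) = true , i
    to (y i) = false , i
    from : Bool × Fin k → Vtx k
    from (c , i) = vtx c i
    to∘from : ∀ p → to (from p) ≡ p
    to∘from (true  , i) = refl
    to∘from (false , i) = refl
    from∘to : ∀ v → from (to v) ≡ v
    from∘to (x i) = refl
    from∘to (y i) = refl

  Bool×Fin↔Fin : (Bool × Fin k) ↔ Fin (2 * k)
  Bool×Fin↔Fin = ↔-sym (↔-trans *↔× (2↔Bool ×-↔ ↔-refl))

  ⊤⊎Vtx↔Fin : (⊤ ⊎ Vtx k) ↔ Fin (suc (2 * k))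
  ⊤⊎Vtx↔Fin = ↔-sym (↔-trans +↔⊎ (1↔⊤ ⊎-↔ ↔-sym (↔-trans Vtx↔Bool×Fin Bool×Fin↔Fin)))

  _≟_ : DecidableEquality (Vtx k)
  _≟_ = via-injection (↔⇒↣ Vtx↔Bool×Fin) (≡-dec Bool._≟_ Fin._≟_)

  rot : ℕ → Vtx k → Vtx k
  rot n (x i) = x (i ⊕ n)
  rot n (y i) = y (i ⊕ n)

  rot-vtx : ∀ c n i → rot n (vtx c i) ≡ vtx c (i ⊕ n)
  rot-vtx true  n i = refl
  rot-vtx false n i = refl

  rotation : Fin k → (⊤ ⊎ Vtx k) ↔ (⊤ ⊎ Vtx k)
  rotation t = ↔-refl ⊎-↔ mk↔ₛ′ (rot (toℕ t)) (rot (k ∸ toℕ t)) unrotˡ unrotʳ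
    where
    t≤k : toℕ t ≤ k
    t≤k = ℕ.<⇒≤ (toℕ<n t)
    unrotˡ : ∀ v → rot (toℕ t) (rot (k ∸ toℕ t) v) ≡ v
    unrotˡ (x i) = cong x (⊕-cancelˡ i t≤k)
    unrotˡ (y i) = cong y (⊕-cancelˡ i t≤k)
    unrotʳ : ∀ v → rot (k ∸ toℕ t) (rot (toℕ t) v) ≡ v
    unrotʳ (x i) = cong x (⊕-cancelʳ i t≤k)
    unrotʳ (y i) = cong y (⊕-cancelʳ i t≤k)

pattern ∞ = inj₁ tt

module ThreeCycleFactor {V : Set} (_≟_ : DecidableEquality V) {F : V → V} (F-factor : IsOneFactor F)
  {p q : V} (Fp≡q : F p ≡ q) where

  σ : ⊤ ⊎ V → ⊤ ⊎ V
  σ ∞ = inj₂ p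
  σ (inj₂ w) with w ≟ q
  ... | yes _ = ∞
  ... | no  _ = inj₂ (F w)

  σ-arc : ∀ {w} → w ≢ q → σ (inj₂ w) ≡ inj₂ (F w)
  σ-arc {w} w≢q with w ≟ q
  ... | yes w≡q = contradiction w≡q w≢q
  ... | no  _   = refl

  σ-q : σ (inj₂ q) ≡ ∞
  σ-q with q ≟ q
  ... | yes _   = refl
  ... | no  q≢q = contradiction refl q≢q

  Fq≡p : F q ≡ p
  Fq≡p = trans (cong F (sym Fp≡q)) (proj₂ F-factor p)

  σ-p : σ (inj₂ p) ≡ inj₂ q
  σ-p = trans (σ-arc (λ p≡q → proj₁ F-factor p (trans Fp≡q (sym p≡q)))) (cong inj₂ Fp≡q)

  σ-isC23Map : IsC23Map σ
  σ-isC23Map = ∞ , (λ ()) , (λ σ²∞≡∞ → inj₂≢∞ (trans (sym σ-p) σ²∞≡∞)) , trans (cong σ σ-p) σ-q , classify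
    where
    inj₂≢∞ : ∀ {w} → inj₂ w ≢ ∞
    inj₂≢∞ ()

    classify : ∀ v → ((v ≡ ∞) ⊎ (v ≡ σ ∞) ⊎ (v ≡ σ (σ ∞))) ⊎ ((σ v ≢ v) × (σ (σ v) ≡ v))
    classify ∞ = inj₁ (inj₁ refl)
    classify (inj₂ w) = classify-vertex w (w ≟ p) (w ≟ q)
      where
      classify-vertex : ∀ w → Dec (w ≡ p) → Dec (w ≡ q) →
        ((inj₂ w ≡ ∞) ⊎ (inj₂ w ≡ σ ∞) ⊎ (inj₂ w ≡ σ (σ ∞))) ⊎ ((σ (inj₂ w) ≢ inj₂ w) × (σ (σ (inj₂ w)) ≡ inj₂ w))
      classify-vertex w (yes w≡p) _         = inj₁ (inj₂ (inj₁ (cong inj₂ w≡p)))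
      classify-vertex w (no _)    (yes w≡q) = inj₁ (inj₂ (inj₂ (trans (cong inj₂ w≡q) (sym σ-p))))
      classify-vertex w (no w≢p)  (no w≢q)  = inj₂
        ((λ σw≡w → proj₁ F-factor w (inj₂-injective (trans (sym (σ-arc w≢q)) σw≡w))) ,
         trans (cong σ (σ-arc w≢q)) (trans (σ-arc Fw≢q) (cong inj₂ (proj₂ F-factor w))))
        where
        Fw≢q : F w ≢ q
        Fw≢q Fw≡q = w≢p (trans (sym (proj₂ F-factor w)) (trans (cong F Fw≡q) Fq≡p))

pure-length-of-complement : ∀ {ℓ δ} → δ < suc (2 * ℓ) → ¬ δ ≤ ℓ →
  (1 ≤ suc (2 * ℓ) ∸ δ) × (suc (2 * ℓ) ∸ δ ≤ ℓ)
pure-length-of-complement {ℓ} {δ} δ<k δ≰ℓ = ℕ.m<n⇒0<n∸m δ<k , (begin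
  suc (2 * ℓ) ∸ δ      ≤⟨ ℕ.∸-monoʳ-≤ (suc (2 * ℓ)) (ℕ.≰⇒> δ≰ℓ) ⟩
  ℓ + (ℓ + 0) ∸ ℓ      ≡⟨ ℕ.m+n∸m≡n ℓ (ℓ + 0) ⟩
  ℓ + 0                ≡⟨ ℕ.+-identityʳ ℓ ⟩
  ℓ                    ∎)
  where open ℕ.≤-Reasoning

module Construction (ℓ : ℕ) (F : Bool → Vtx (suc (2 * ℓ)) → Vtx (suc (2 * ℓ)))
  (F-factor : ∀ s → IsOneFactor (F s)) where

  k : ℕ
  k = suc (2 * ℓ)

  open Cyclic k
  open Vertices k

  reverse : ∀ {s u w} → F s u ≡ w → F s w ≡ u
  reverse {s} {u} Fu≡w = trans (cong (F s) (sym Fu≡w)) (proj₂ (F-factor s) u)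

  PureArc : Bool → ℕ → Set
  PureArc c d = Σ Bool λ s → Σ (Fin k) λ a → Σ (Fin k) λ b → (F s (vtx c a) ≡ vtx c b) × (b ≡ a ⊕ d)

  MixedArc : ℕ → Set
  MixedArc d = Σ Bool λ s → Σ (Fin k) λ a → Σ (Fin k) λ b → (F s (x a) ≡ y b) × (diff k a b ≡ d)

  inUnion⇒arc : ∀ {u w} → InUnion (F true) (F false) u w → Σ Bool λ s → F s u ≡ w
  inUnion⇒arc (inj₁ F₁u≡w) = true , F₁u≡w
  inUnion⇒arc (inj₂ F₂u≡w) = false , F₂u≡w

  leftEdge⇒PureArc : ∀ {d} → ExactlyOneEdge (λ u w → InUnion (F true) (F false) u w × LeftPure k d u w) →
    PureArc true d
  leftEdge⇒PureArc (u , w , (u~w , pure) , _) = arc u w (inUnion⇒arc u~w) pure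
    where
    arc : ∀ {d} u w → (Σ Bool λ s → F s u ≡ w) → LeftPure k d u w → PureArc true d
    arc (x a) (x b) (s , Fa≡b) (inj₁ dab) = s , a , b , Fa≡b , diff⇒⊕ a b dab
    arc (x a) (x b) (s , Fa≡b) (inj₂ dba) = s , b , a , reverse Fa≡b , diff⇒⊕ b a dba
    arc (x a) (y b) _ ()
    arc (y a) _     _ ()

  rightEdge⇒PureArc : ∀ {d} → ExactlyOneEdge (λ u w → InUnion (F true) (F false) u w × RightPure k d u w) →
    PureArc false d
  rightEdge⇒PureArc (u , w , (u~w , pure) , _) = arc u w (inUnion⇒arc u~w) pure
    where
    arc : ∀ {d} u w → (Σ Bool λ s → F s u ≡ w) → RightPure k d u w → PureArc false d
    arc (y a) (y b) (s , Fa≡b) (inj₁ dab) = s , a , b , Fa≡b , diff⇒⊕ a b dab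
    arc (y a) (y b) (s , Fa≡b) (inj₂ dba) = s , b , a , reverse Fa≡b , diff⇒⊕ b a dba
    arc (y a) (x b) _ ()
    arc (x a) _     _ ()

  mixedEdge⇒MixedArc : ∀ {d} → ExactlyOneEdge (λ u w → InUnion (F true) (F false) u w × Mixed k d u w) →
    MixedArc d
  mixedEdge⇒MixedArc (u , w , (u~w , mixed) , _) = arc u w (inUnion⇒arc u~w) mixed
    where
    arc : ∀ {d} u w → (Σ Bool λ s → F s u ≡ w) → Mixed k d u w → MixedArc d
    arc (x a) (y b) (s , Fa≡b) dab = s , a , b , Fa≡b , dab
    arc (y b) (x a) (s , Fb≡a) dab = s , a , b , reverse Fb≡a , dab
    arc (x a) (x b) _ ()
    arc (y a) (y b) _ ()

  zeroEdge⇒arc : ∀ {s} → ExactlyOneEdge (λ u w → (F s u ≡ w) × Mixed k 0 u w) → Σ (Fin k) λ a → F s (x a) ≡ y a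
  zeroEdge⇒arc {s} (u , w , (Fu≡w , mixed) , _) = arc u w Fu≡w mixed
    where
    arc : ∀ u w → F s u ≡ w → Mixed k 0 u w → Σ (Fin k) λ a → F s (x a) ≡ y a
    arc (x a) (y b) Fa≡b dab≡0 = a , trans Fa≡b (cong y (sym (diff≡0⇒≡ dab≡0)))
    arc (y b) (x a) Fb≡a dab≡0 = a , trans (reverse Fb≡a) (cong y (sym (diff≡0⇒≡ dab≡0)))
    arc (x a) (x b) _ ()
    arc (y a) (y b) _ ()

  module _ (zero-arcs : ∀ s → Σ (Fin k) λ a → F s (x a) ≡ y a)
    (pure-arcs : ∀ c d → 1 ≤ d → d ≤ ℓ → PureArc c d)
    (mixed-arcs : ∀ d → 1 ≤ d → d < k → MixedArc d) where

    centre : Bool → Fin k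
    centre s = proj₁ (zero-arcs s)

    -- The 3-cycle of factor true is ∞ → x → y → ∞, that of factor false is ∞ → y → x → ∞.
    p q : Bool → Vtx k
    p s = vtx s (centre s)
    q s = vtx (Bool.not s) (centre s)

    Fp≡q : ∀ s → F s (p s) ≡ q s
    Fp≡q true  = proj₂ (zero-arcs true)
    Fp≡q false = reverse (proj₂ (zero-arcs false))

    module Base (s : Bool) = ThreeCycleFactor _≟_ (F-factor s) (Fp≡q s)

    σ : Bool → ⊤ ⊎ Vtx k → ⊤ ⊎ Vtx k
    σ = Base.σ

    σ-arc : ∀ s {w w′} → F s w ≡ w′ → ¬ Mixed k 0 w w′ → σ s (inj₂ w) ≡ inj₂ w′
    σ-arc s {w} {w′} Fw≡w′ w~w′≢0 = trans (Base.σ-arc s w≢q) (cong inj₂ Fw≡w′)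
      where
      q~p : ∀ s → Mixed k 0 (q s) (p s)
      q~p true  = diff-self (centre true)
      q~p false = diff-self (centre false)
      w≢q : w ≢ q s
      w≢q refl = w~w′≢0 (subst (Mixed k 0 (q s)) (trans (sym (Base.Fq≡p s)) Fw≡w′) (q~p s))

    τ : Bool × Fin k → ⊤ ⊎ Vtx k → ⊤ ⊎ Vtx k
    τ (s , t) = conjugate (rotation t) (σ s)

    τ-isC23Map : ∀ i → IsC23Map (τ i)
    τ-isC23Map (s , t) = IsC23Map-conjugate (rotation t) (Base.σ-isC23Map s)

    rotate : Fin k → ⊤ ⊎ Vtx k → ⊤ ⊎ Vtx k
    rotate t = Inverse.to (rotation t)

    rotate-vtx : ∀ c t a {i} → a ⊕ toℕ t ≡ i → rotate t (inj₂ (vtx c a)) ≡ inj₂ (vtx c i)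
    rotate-vtx c t a a⊕t≡i = cong inj₂ (trans (rot-vtx c (toℕ t) a) (cong (vtx c) a⊕t≡i))

    Covered : ⊤ ⊎ Vtx k → ⊤ ⊎ Vtx k → Set
    Covered u v = Σ (Bool × Fin k) λ i → τ i u ≡ v

    covered-by : ∀ s t {w w′ u v} → σ s w ≡ w′ → rotate t w ≡ u → rotate t w′ ≡ v → Covered u v
    covered-by s t {w} {w′} {u} {v} σw≡w′ w↦u w′↦v = (s , t) , (begin
      τ (s , t) u                ≡⟨ cong (τ (s , t)) w↦u ⟨
      τ (s , t) (rotate t w)     ≡⟨ conjugate-to (rotation t) (σ s) w ⟩
      rotate t (σ s w)           ≡⟨ cong (rotate t) σw≡w′ ⟩
      rotate t w′                ≡⟨ w′↦v ⟩
      v                          ∎)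
      where open ≡-Reasoning

    cover-from-∞ : ∀ s i → Covered ∞ (inj₂ (vtx s i))
    cover-from-∞ s i with t , e ← ⊕-transitive (centre s) i =
      covered-by s t {w = ∞} refl refl (rotate-vtx s t (centre s) e)

    cover-through-centre : ∀ s i → Covered (inj₂ (vtx s i)) (inj₂ (vtx (Bool.not s) i))
    cover-through-centre s i with t , e ← ⊕-transitive (centre s) i =
      covered-by s t (Base.σ-p s) (rotate-vtx s t (centre s) e) (rotate-vtx (Bool.not s) t (centre s) e)

    cover-to-∞ : ∀ s i → Covered (inj₂ (vtx (Bool.not s) i)) ∞
    cover-to-∞ s i with t , e ← ⊕-transitive (centre s) i =
      covered-by s t (Base.σ-q s) (rotate-vtx (Bool.not s) t (centre s) e) refl

    pure-arc-of-difference : ∀ c δ → 1 ≤ δ → δ < k → PureArc c δ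
    pure-arc-of-difference c δ 1≤δ δ<k with δ ℕ.≤? ℓ
    ... | yes δ≤ℓ = pure-arcs c δ 1≤δ δ≤ℓ
    ... | no  δ≰ℓ with (1≤k-δ , k-δ≤ℓ) ← pure-length-of-complement δ<k δ≰ℓ
                  with s , a , b , Fa≡b , b≡a⊕k-δ ← pure-arcs c (k ∸ δ) 1≤k-δ k-δ≤ℓ =
      s , b , a , reverse Fa≡b , sym (trans (cong (_⊕ δ) b≡a⊕k-δ) (⊕-cancelˡ a (ℕ.<⇒≤ δ<k)))

    cover-pure : ∀ c {i j} → i ≢ j → Covered (inj₂ (vtx c i)) (inj₂ (vtx c j))
    cover-pure c {i} {j} i≢j
      with s , a , b , Fa≡b , b≡a⊕δ ← pure-arc-of-difference c (diff k i j) (≢⇒diff>0 i≢j) (diff<k i j)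
      with t , a⊕t≡i , b⊕t≡j ← ⊕-transitive-pairs a i b≡a⊕δ (diff⇒⊕ i j refl) =
      covered-by s t (σ-arc s Fa≡b (pure≢0 c)) (rotate-vtx c t a a⊕t≡i) (rotate-vtx c t b b⊕t≡j)
      where
      pure≢0 : ∀ c {a b} → ¬ Mixed k 0 (vtx c a) (vtx c b)
      pure≢0 true  ()
      pure≢0 false ()

    mixed≢0 : ∀ {m d} → m ≡ d → 1 ≤ d → m ≢ 0
    mixed≢0 m≡d 1≤d m≡0 = ℕ.<⇒≢ 1≤d (trans (sym m≡0) m≡d)

    cover-xy : ∀ {i j} → i ≢ j → Covered (inj₂ (x i)) (inj₂ (y j))
    cover-xy {i} {j} i≢j
      with s , a , b , Fa≡b , dab≡δ ← mixed-arcs (diff k i j) (≢⇒diff>0 i≢j) (diff<k i j)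
      with t , a⊕t≡i , b⊕t≡j ← ⊕-transitive-pairs a i (diff⇒⊕ a b dab≡δ) (diff⇒⊕ i j refl) =
      covered-by s t (σ-arc s Fa≡b (mixed≢0 dab≡δ (≢⇒diff>0 i≢j)))
        (rotate-vtx true t a a⊕t≡i) (rotate-vtx false t b b⊕t≡j)

    cover-yx : ∀ {i j} → j ≢ i → Covered (inj₂ (y i)) (inj₂ (x j))
    cover-yx {i} {j} j≢i
      with s , a , b , Fa≡b , dab≡δ ← mixed-arcs (diff k j i) (≢⇒diff>0 j≢i) (diff<k j i)
      with t , a⊕t≡j , b⊕t≡i ← ⊕-transitive-pairs a j (diff⇒⊕ a b dab≡δ) (diff⇒⊕ j i refl) =
      covered-by s t (σ-arc s (reverse Fa≡b) (mixed≢0 dab≡δ (≢⇒diff>0 j≢i)))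
        (rotate-vtx false t b b⊕t≡i) (rotate-vtx true t a a⊕t≡j)

    cover : ∀ u v → u ≢ v → Covered u v
    cover ∞            ∞            ∞≢∞ = contradiction refl ∞≢∞
    cover ∞            (inj₂ (x i)) _   = cover-from-∞ true i
    cover ∞            (inj₂ (y i)) _   = cover-from-∞ false i
    cover (inj₂ (x i)) ∞            _   = cover-to-∞ false i
    cover (inj₂ (y i)) ∞            _   = cover-to-∞ true i
    cover (inj₂ (x i)) (inj₂ (x j)) u≢v = cover-pure true (u≢v ∘ cong (inj₂ ∘ x))
    cover (inj₂ (y i)) (inj₂ (y j)) u≢v = cover-pure false (u≢v ∘ cong (inj₂ ∘ y))
    cover (inj₂ (x i)) (inj₂ (y j)) _ with i Fin.≟ j
    ... | yes refl = cover-through-centre true i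
    ... | no  i≢j  = cover-xy i≢j
    cover (inj₂ (y i)) (inj₂ (x j)) _ with j Fin.≟ i
    ... | yes refl = cover-through-centre false j
    ... | no  j≢i  = cover-yx j≢i

    factorization : HasC23Factorization (suc (2 * k))
    factorization = c23Factorization-via ⊤⊎Vtx↔Fin Bool×Fin↔Fin τ τ-isC23Map cover

vertex-count : ∀ ℓ → suc (2 * suc (2 * ℓ)) ≡ 4 * ℓ + 3
vertex-count = solve-∀

lemma3p8 : (ℓ : ℕ) → 1 ≤ ℓ →
    (F₁ F₂ : Vtx (suc (2 * ℓ)) → Vtx (suc (2 * ℓ))) →
    IsOneFactor F₁ → IsOneFactor F₂ →
    (∀ d → 1 ≤ d → d ≤ ℓ →
      ExactlyOneEdge (λ u w → InUnion F₁ F₂ u w × LeftPure (suc (2 * ℓ)) d u w)) →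
    (∀ d → 1 ≤ d → d ≤ ℓ →
      ExactlyOneEdge (λ u w → InUnion F₁ F₂ u w × RightPure (suc (2 * ℓ)) d u w)) →
    (∀ d → 1 ≤ d → d < suc (2 * ℓ) →
      ExactlyOneEdge (λ u w → InUnion F₁ F₂ u w × Mixed (suc (2 * ℓ)) d u w)) →
    ExactlyOneEdge (λ u w → (F₁ u ≡ w) × Mixed (suc (2 * ℓ)) 0 u w) →
    ExactlyOneEdge (λ u w → (F₂ u ≡ w) × Mixed (suc (2 * ℓ)) 0 u w) →
    HasC23Factorization (4 * ℓ + 3)
lemma3p8 ℓ _ F₁ F₂ F₁-factor F₂-factor left right mixed zero₁ zero₂ =
  subst HasC23Factorization (vertex-count ℓ) (factorization zero-arcs pure-arcs mixed-arcs)
  where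
  F : Bool → Vtx (suc (2 * ℓ)) → Vtx (suc (2 * ℓ))
  F true  = F₁
  F false = F₂

  F-factor : ∀ s → IsOneFactor (F s)
  F-factor true  = F₁-factor
  F-factor false = F₂-factor

  open Construction ℓ F F-factor

  zero-arcs : ∀ s → Σ (Fin k) λ a → F s (x a) ≡ y a
  zero-arcs true  = zeroEdge⇒arc zero₁
  zero-arcs false = zeroEdge⇒arc zero₂

  pure-arcs : ∀ c d → 1 ≤ d → d ≤ ℓ → PureArc c d
  pure-arcs true  d 1≤d d≤ℓ = leftEdge⇒PureArc (left d 1≤d d≤ℓ)
  pure-arcs false d 1≤d d≤ℓ = rightEdge⇒PureArc (right d 1≤d d≤ℓ)

  mixed-arcs : ∀ d → 1 ≤ d → d < k → MixedArc d
  mixed-arcs d 1≤d d<k = mixedEdge⇒MixedArc (mixed d 1≤d d<k)
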